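{- For all $\phi,\chi\in\mathcal{L}_\blacktriangle$: if there is an $\mathbb{S}(\mathbf{K}^\blacktriangle_\mathbf{FDE})$ proof of $\phi\vdash\chi$, then every labelled formula $w:\psi;\mathfrak{v}$ appearing in it has $\psi$ a subformula of $\phi$ or of $\chi$.
   Context: Formulas of $\mathcal{L}_\blacktriangle$: $\phi::=p\mid\neg\phi\mid\phi\wedge\phi\mid\phi\vee\phi\mid\blacktriangle\phi$, $p$ in a countable set $\mathsf{Var}$. Calculus $\mathbb{S}(\mathbf{K}^\blacktriangle_\mathbf{FDE})$. Fix a countable set of state-labels and value-labels $\{\mathfrak{t},\mathfrak{f},\overline{\mathfrak{t}},\overline{\mathfrak{f}}\}$. A labelled formula is $w:\phi;\mathfrak{v}$. Conventions: $\overline{\overline{\mathfrak{t}}}=\mathfrak{t}$, $\overline{\overline{\mathfrak{f}}}=\mathfrak{f}$; $\mathfrak{t}^\neg=\mathfrak{f}$, $\mathfrak{f}^\neg=\mathfrak{t}$, $\overline{\mathfrak{t}}^\neg=\overline{\mathfrak{f}}$, $\overline{\mathfrak{f}}^\neg=\overline{\mathfrak{t}}$; $w:\phi;\mathfrak{v}_1;\mathfrak{v}_2$ abbreviates $w:\phi;\mathfrak{v}_1$ and $w:\phi;\mathfrak{v}_2$. A tree is downward-branching with nodes being sets of labelled formulas and relational atoms $w\mathsf{R}w'$; a branch may be extended by the rules below (premises before $\Rightarrow$; $\{i,j\}=\{1,2\}$; $w_k,w_{k_1},w_{k_2}$ fresh on the branch): $\neg$: $w:\neg\phi;\mathfrak{t}\Rightarrow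 w:\phi;\mathfrak{f}$; $w:\neg\phi;\mathfrak{f}\Rightarrow w:\phi;\mathfrak{t}$; $w:\neg\phi;\overline{\mathfrak{t}}\Rightarrow w:\phi;\overline{\mathfrak{f}}$; $w:\neg\phi;\overline{\mathfrak{f}}\Rightarrow w:\phi;\overline{\mathfrak{t}}$. $\wedge$: $w:\phi_1\wedge\phi_2;\mathfrak{t}\Rightarrow w:\phi_1;\mathfrak{t}$ and $w:\phi_2;\mathfrak{t}$; $w:\phi_1\wedge\phi_2;\mathfrak{f}$, $w:\phi_i;\overline{\mathfrak{f}}\Rightarrow w:\phi_j;\mathfrak{f}$; $w:\phi_1\wedge\phi_2;\overline{\mathfrak{t}}$, $w:\phi_i;\mathfrak{t}\Rightarrow w:\phi_j;\overline{\mathfrak{t}}$; $w:\phi_1\wedge\phi_2;\overline{\mathfrak{f}}\Rightarrow w:\phi_1;\overline{\mathfrak{f}}$ and $w:\phi_2;\overline{\mathfrak{f}}$. $\vee$: $w:\phi_1\vee\phi_2;\mathfrak{t}$, $w:\phi_i;\overline{\mathfrak{t}}\Rightarrow w:\phi_j;\mathfrak{t}$; $w:\phi_1\vee\phi_2;\mathfrak{f}\Rightarrow w:\phi_1;\mathfrak{f}$ and $w:\phi_2;\mathfrak{f}$; $w:\phi_1\vee\phi_2;\overline{\mathfrak{t}}\Rightarrow w:\phi_1;\overline{\mathfrak{t}}$ and $w:\phi_2;\overline{\mathfrak{t}}$; $w:\phi_1\vee\phi_2;\overline{\mathfrak{f}}$, $w:\phi_i;\mathfrak{f}\Rightarrow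 w:\phi_j;\overline{\mathfrak{f}}$. Cut: with no premises, split the branch into $w:\phi;\mathfrak{v}\mid w:\phi;\overline{\mathfrak{v}}$, provided $\phi$ is a subformula of a formula on the branch and $w$ occurs on the branch. $\blacktriangle_T$: $w_i:\blacktriangle\phi;\mathfrak{t};\overline{\mathfrak{f}}$, $w_i\mathsf{R}w_j$, $w_j:\phi;\mathfrak{v}\Rightarrow w_j:\phi;\overline{\mathfrak{v}}^\neg$. $\blacktriangle'_T$: $w_i:\blacktriangle\phi;\mathfrak{t};\overline{\mathfrak{f}}$, $w_i\mathsf{R}w_{j_1}$, $w_i\mathsf{R}w_{j_2}$, $w_{j_1}:\phi;\mathfrak{v};\overline{\mathfrak{v}}^\neg\Rightarrow w_{j_2}:\phi;\mathfrak{v};\overline{\mathfrak{v}}^\neg$. $\blacktriangle_F$: $w_i:\blacktriangle\phi;\mathfrak{f};\overline{\mathfrak{t}}\Rightarrow$ add $w_i\mathsf{R}w_{k_1}$, $w_i\mathsf{R}w_{k_2}$, then split into $\{w_{k_1}:\phi;\mathfrak{t},\ w_{k_2}:\phi;\overline{\mathfrak{t}}\}\mid\{w_{k_1}:\phi;\mathfrak{f},\ w_{k_2}:\phi;\overline{\mathfrak{f}}\}$. $\blacktriangle_B$: $w_i:\blacktriangle\phi;\mathfrak{t};\mathfrak{f}$, $w_i\mathsf{R}w_j\Rightarrow w_j:\phi;\mathfrak{t};\mathfrak{f}$. $\blacktriangle^+_B$: $w_i:\blacktriangle\phi;\mathfrak{t};\mathfrak{f}\Rightarrow w_i\mathsf{R}w_k$,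 $w_k:\phi;\mathfrak{t};\mathfrak{f}$. $\blacktriangle_N$: $w_i:\blacktriangle\phi;\overline{\mathfrak{t}};\overline{\mathfrak{f}}$, $w_i\mathsf{R}w_j\Rightarrow w_j:\phi;\overline{\mathfrak{t}};\overline{\mathfrak{f}}$. $\blacktriangle^+_N$: $w_i:\blacktriangle\phi;\overline{\mathfrak{t}};\overline{\mathfrak{f}}\Rightarrow w_i\mathsf{R}w_k$, $w_k:\phi;\overline{\mathfrak{t}};\overline{\mathfrak{f}}$. A branch is closed iff it contains $w:\phi;\mathfrak{v}$ and $w:\phi;\overline{\mathfrak{v}}$ for some $w,\phi,\mathfrak{v}$; a tree is closed iff all its branches are closed. A proof of $\phi\vdash\chi$ is a closed tree with root $\{w_0:\phi;\mathfrak{t},\ w_0:\chi;\overline{\mathfrak{t}}\}$. -}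

module Defs where

open import Data.Nat using (ℕ)
open import Data.List using (List; []; _∷_; [_]; _++_)
open import Data.List.Membership.Propositional using (_∈_)
open import Data.List.Relation.Unary.Any using (Any)
open import Data.Product using (Σ; ∃; _×_)
open import Relation.Binary.PropositionalEquality using (_≡_; _≢_)
open import Relation.Nullary using (¬_)

infixr 6 _∧'_
infixr 5 _∨'_

data Fm : Set where
  var  : ℕ → Fm
  ¬'_  : Fm → Fm
  _∧'_ : Fm → Fm → Fm
  _∨'_ : Fm → Fm → Fm
  ▲_   : Fm → Fm

data _⊑_ : Fm → Fm → Set where
  ⊑-refl : ∀ {φ} → φ ⊑ φ
  ⊑-¬    : ∀ {φ ψ} → φ ⊑ ψ → φ ⊑ (¬' ψ)
  ⊑-∧ˡ   : ∀ {φ ψ₁ ψ₂} → φ ⊑ ψ₁ → φ ⊑ (ψ₁ ∧' ψ₂)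
  ⊑-∧ʳ   : ∀ {φ ψ₁ ψ₂} → φ ⊑ ψ₂ → φ ⊑ (ψ₁ ∧' ψ₂)
  ⊑-∨ˡ   : ∀ {φ ψ₁ ψ₂} → φ ⊑ ψ₁ → φ ⊑ (ψ₁ ∨' ψ₂)
  ⊑-∨ʳ   : ∀ {φ ψ₁ ψ₂} → φ ⊑ ψ₂ → φ ⊑ (ψ₁ ∨' ψ₂)
  ⊑-▲    : ∀ {φ ψ} → φ ⊑ ψ → φ ⊑ (▲ ψ)

data V : Set where
  𝔱 𝔣 𝔱̄ 𝔣̄ : V

bar : V → V
bar 𝔱 = 𝔱̄
bar 𝔣 = 𝔣̄
bar 𝔱̄ = 𝔱
bar 𝔣̄ = 𝔣

neg : V → V
neg 𝔱 = 𝔣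
neg 𝔣 = 𝔱
neg 𝔱̄ = 𝔣̄
neg 𝔣̄ = 𝔱̄

-- Items on a branch: labelled formulas w:φ;v and relational atoms wRw'
-- (state labels are natural numbers)

data Item : Set where
  lf  : ℕ → Fm → V → Item
  rel : ℕ → ℕ → Item

Branch : Set
Branch = List Item

statesOf : Item → List ℕ
statesOf (lf w _ _) = [ w ]
statesOf (rel a b)  = a ∷ b ∷ []

OccursSt : ℕ → Branch → Set
OccursSt w Γ = Any (λ it → w ∈ statesOf it) Γ

Fresh : ℕ → Branch → Set
Fresh k Γ = ¬ OccursSt k Γ

SubOnBranch : Fm → Branch → Set
SubOnBranch φ Γ = Σ ℕ λ w → Σ Fm λ ψ → Σ V λ v → (lf w ψ v ∈ Γ) × (φ ⊑ ψ)

Closed : Branch → Set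
Closed Γ = Σ ℕ λ w → Σ Fm λ φ → Σ V λ v → (lf w φ v ∈ Γ) × (lf w φ (bar v) ∈ Γ)

data Step1 (Γ : Branch) : Branch → Set where
  r¬    : ∀ {w φ v} → lf w (¬' φ) v ∈ Γ → Step1 Γ [ lf w φ (neg v) ]
  r∧𝔱   : ∀ {w φ ψ} → lf w (φ ∧' ψ) 𝔱 ∈ Γ → Step1 Γ (lf w φ 𝔱 ∷ lf w ψ 𝔱 ∷ [])
  r∧𝔣₁  : ∀ {w φ ψ} → lf w (φ ∧' ψ) 𝔣 ∈ Γ → lf w φ 𝔣̄ ∈ Γ → Step1 Γ [ lf w ψ 𝔣 ]
  r∧𝔣₂  : ∀ {w φ ψ} → lf w (φ ∧' ψ) 𝔣 ∈ Γ → lf w ψ 𝔣̄ ∈ Γ → Step1 Γ [ lf w φ 𝔣 ]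
  r∧𝔱̄₁  : ∀ {w φ ψ} → lf w (φ ∧' ψ) 𝔱̄ ∈ Γ → lf w φ 𝔱 ∈ Γ → Step1 Γ [ lf w ψ 𝔱̄ ]
  r∧𝔱̄₂  : ∀ {w φ ψ} → lf w (φ ∧' ψ) 𝔱̄ ∈ Γ → lf w ψ 𝔱 ∈ Γ → Step1 Γ [ lf w φ 𝔱̄ ]
  r∧𝔣̄   : ∀ {w φ ψ} → lf w (φ ∧' ψ) 𝔣̄ ∈ Γ → Step1 Γ (lf w φ 𝔣̄ ∷ lf w ψ 𝔣̄ ∷ [])
  r∨𝔱₁  : ∀ {w φ ψ} → lf w (φ ∨' ψ) 𝔱 ∈ Γ → lf w φ 𝔱̄ ∈ Γ → Step1 Γ [ lf w ψ 𝔱 ]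
  r∨𝔱₂  : ∀ {w φ ψ} → lf w (φ ∨' ψ) 𝔱 ∈ Γ → lf w ψ 𝔱̄ ∈ Γ → Step1 Γ [ lf w φ 𝔱 ]
  r∨𝔣   : ∀ {w φ ψ} → lf w (φ ∨' ψ) 𝔣 ∈ Γ → Step1 Γ (lf w φ 𝔣 ∷ lf w ψ 𝔣 ∷ [])
  r∨𝔱̄   : ∀ {w φ ψ} → lf w (φ ∨' ψ) 𝔱̄ ∈ Γ → Step1 Γ (lf w φ 𝔱̄ ∷ lf w ψ 𝔱̄ ∷ [])
  r∨𝔣̄₁  : ∀ {w φ ψ} → lf w (φ ∨' ψ) 𝔣̄ ∈ Γ → lf w φ 𝔣 ∈ Γ → Step1 Γ [ lf w ψ 𝔣̄ ]
  r∨𝔣̄₂  : ∀ {w φ ψ} → lf w (φ ∨' ψ) 𝔣̄ ∈ Γ → lf w ψ 𝔣 ∈ Γ → Step1 Γ [ lf w φ 𝔣̄ ]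
  r▲T   : ∀ {i j φ v} → lf i (▲ φ) 𝔱 ∈ Γ → lf i (▲ φ) 𝔣̄ ∈ Γ → rel i j ∈ Γ
          → lf j φ v ∈ Γ → Step1 Γ [ lf j φ (neg (bar v)) ]
  r▲T′  : ∀ {i j₁ j₂ φ v} → lf i (▲ φ) 𝔱 ∈ Γ → lf i (▲ φ) 𝔣̄ ∈ Γ
          → rel i j₁ ∈ Γ → rel i j₂ ∈ Γ
          → lf j₁ φ v ∈ Γ → lf j₁ φ (neg (bar v)) ∈ Γ
          → Step1 Γ (lf j₂ φ v ∷ lf j₂ φ (neg (bar v)) ∷ [])
  r▲B   : ∀ {i j φ} → lf i (▲ φ) 𝔱 ∈ Γ → lf i (▲ φ) 𝔣 ∈ Γ → rel i j ∈ Γ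
          → Step1 Γ (lf j φ 𝔱 ∷ lf j φ 𝔣 ∷ [])
  r▲B⁺  : ∀ {i k φ} → lf i (▲ φ) 𝔱 ∈ Γ → lf i (▲ φ) 𝔣 ∈ Γ → Fresh k Γ
          → Step1 Γ (rel i k ∷ lf k φ 𝔱 ∷ lf k φ 𝔣 ∷ [])
  r▲N   : ∀ {i j φ} → lf i (▲ φ) 𝔱̄ ∈ Γ → lf i (▲ φ) 𝔣̄ ∈ Γ → rel i j ∈ Γ
          → Step1 Γ (lf j φ 𝔱̄ ∷ lf j φ 𝔣̄ ∷ [])
  r▲N⁺  : ∀ {i k φ} → lf i (▲ φ) 𝔱̄ ∈ Γ → lf i (▲ φ) 𝔣̄ ∈ Γ → Fresh k Γ
          → Step1 Γ (rel i k ∷ lf k φ 𝔱̄ ∷ lf k φ 𝔣̄ ∷ [])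

data Step2 (Γ : Branch) : Branch → Branch → Set where
  cut  : ∀ {w φ v} → OccursSt w Γ → SubOnBranch φ Γ
         → Step2 Γ [ lf w φ v ] [ lf w φ (bar v) ]
  r▲F  : ∀ {i k₁ k₂ φ} → lf i (▲ φ) 𝔣 ∈ Γ → lf i (▲ φ) 𝔱̄ ∈ Γ
         → Fresh k₁ Γ → Fresh k₂ Γ → k₁ ≢ k₂
         → Step2 Γ (rel i k₁ ∷ rel i k₂ ∷ lf k₁ φ 𝔱 ∷ lf k₂ φ 𝔱̄ ∷ [])
                   (rel i k₁ ∷ rel i k₂ ∷ lf k₁ φ 𝔣 ∷ lf k₂ φ 𝔣̄ ∷ [])

data ClosedTree (Γ : Branch) : Set where
  close : Closed Γ → ClosedTree Γ
  ext   : ∀ {Δ} → Step1 Γ Δ → ClosedTree (Δ ++ Γ) → ClosedTree Γ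
  split : ∀ {Δ₁ Δ₂} → Step2 Γ Δ₁ Δ₂
          → ClosedTree (Δ₁ ++ Γ) → ClosedTree (Δ₂ ++ Γ) → ClosedTree Γ

data _∈T_ (x : Item) : ∀ {Γ} → ClosedTree Γ → Set where
  here   : ∀ {Γ} {t : ClosedTree Γ} → x ∈ Γ → x ∈T t
  inExt  : ∀ {Γ Δ} {s : Step1 Γ Δ} {t : ClosedTree (Δ ++ Γ)}
           → x ∈T t → x ∈T ext s t
  inSplˡ : ∀ {Γ Δ₁ Δ₂} {s : Step2 Γ Δ₁ Δ₂}
             {t₁ : ClosedTree (Δ₁ ++ Γ)} {t₂ : ClosedTree (Δ₂ ++ Γ)}
           → x ∈T t₁ → x ∈T split s t₁ t₂
  inSplʳ : ∀ {Γ Δ₁ Δ₂} {s : Step2 Γ Δ₁ Δ₂}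
             {t₁ : ClosedTree (Δ₁ ++ Γ)} {t₂ : ClosedTree (Δ₂ ++ Γ)}
           → x ∈T t₂ → x ∈T split s t₁ t₂

root : Fm → Fm → Branch
root φ χ = lf 0 φ 𝔱 ∷ lf 0 χ 𝔱̄ ∷ []

Proof : Fm → Fm → Set
Proof φ χ = ClosedTree (root φ χ)

{-# OPTIONS --safe #-}
-- Every rule adds only formulas that are subformulas of formulas already on
-- the branch (cut is restricted to exactly those), so any subformula-closed
-- set of formulas containing the root formulas contains every formula on
-- every branch of the tree.
module Submission where

open import Defs
open import Data.Nat using (ℕ)
open import Data.Sum as Sum using (_⊎_; inj₁; inj₂)
open import Data.Product using (_,_; _×_)
open import Data.Unit using (⊤; tt)
open import Data.List using ([]; _∷_)
open import Data.List.Membership.Propositional using (_∈_)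
open import Data.List.Relation.Unary.All using (All; []; _∷_; lookup)
open import Data.List.Relation.Unary.All.Properties using (++⁺)
open import Relation.Unary using (Pred; _∪_)

⊑-trans : ∀ {φ ψ χ} → φ ⊑ ψ → ψ ⊑ χ → φ ⊑ χ
⊑-trans p ⊑-refl   = p
⊑-trans p (⊑-¬ q)  = ⊑-¬ (⊑-trans p q)
⊑-trans p (⊑-∧ˡ q) = ⊑-∧ˡ (⊑-trans p q)
⊑-trans p (⊑-∧ʳ q) = ⊑-∧ʳ (⊑-trans p q)
⊑-trans p (⊑-∨ˡ q) = ⊑-∨ˡ (⊑-trans p q)
⊑-trans p (⊑-∨ʳ q) = ⊑-∨ʳ (⊑-trans p q)
⊑-trans p (⊑-▲ q)  = ⊑-▲ (⊑-trans p q)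

SubformulaClosed : Pred Fm _ → Set
SubformulaClosed P = ∀ {φ ψ} → ψ ⊑ φ → P φ → P ψ

subformulasOf-closed : ∀ φ → SubformulaClosed (_⊑ φ)
subformulasOf-closed φ = ⊑-trans

∪-subformulaClosed : ∀ {P Q} → SubformulaClosed P → SubformulaClosed Q
                   → SubformulaClosed (P ∪ Q)
∪-subformulaClosed P-closed Q-closed ψ⊑φ = Sum.map (P-closed ψ⊑φ) (Q-closed ψ⊑φ)

FormulaIn : Pred Fm _ → Item → Set
FormulaIn P (lf _ ψ _) = P ψ
FormulaIn P (rel _ _)  = ⊤

module _ {P : Pred Fm _} (closed : SubformulaClosed P) where

  private
    below : ∀ {Γ w φ ψ v} → All (FormulaIn P) Γ → ψ ⊑ φ → lf w φ v ∈ Γ → P ψ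
    below onΓ ψ⊑φ φ∈Γ = closed ψ⊑φ (lookup onΓ φ∈Γ)

    ∧ˡ : ∀ {φ ψ} → φ ⊑ (φ ∧' ψ)
    ∧ˡ = ⊑-∧ˡ ⊑-refl
    ∧ʳ : ∀ {φ ψ} → ψ ⊑ (φ ∧' ψ)
    ∧ʳ = ⊑-∧ʳ ⊑-refl
    ∨ˡ : ∀ {φ ψ} → φ ⊑ (φ ∨' ψ)
    ∨ˡ = ⊑-∨ˡ ⊑-refl
    ∨ʳ : ∀ {φ ψ} → ψ ⊑ (φ ∨' ψ)
    ∨ʳ = ⊑-∨ʳ ⊑-refl
    ▲ : ∀ {φ} → φ ⊑ (▲ φ)
    ▲ = ⊑-▲ ⊑-refl

  step1-preserves : ∀ {Γ Δ} → All (FormulaIn P) Γ → Step1 Γ Δ → All (FormulaIn P) Δ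
  step1-preserves I (r¬ m)                 = below I (⊑-¬ ⊑-refl) m ∷ []
  step1-preserves I (r∧𝔱 m)                = below I ∧ˡ m ∷ below I ∧ʳ m ∷ []
  step1-preserves I (r∧𝔣₁ m _)             = below I ∧ʳ m ∷ []
  step1-preserves I (r∧𝔣₂ m _)             = below I ∧ˡ m ∷ []
  step1-preserves I (r∧𝔱̄₁ m _)             = below I ∧ʳ m ∷ []
  step1-preserves I (r∧𝔱̄₂ m _)             = below I ∧ˡ m ∷ []
  step1-preserves I (r∧𝔣̄ m)                = below I ∧ˡ m ∷ below I ∧ʳ m ∷ []
  step1-preserves I (r∨𝔱₁ m _)             = below I ∨ʳ m ∷ []
  step1-preserves I (r∨𝔱₂ m _)             = below I ∨ˡ m ∷ []
  step1-preserves I (r∨𝔣 m)                = below I ∨ˡ m ∷ below I ∨ʳ m ∷ []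
  step1-preserves I (r∨𝔱̄ m)                = below I ∨ˡ m ∷ below I ∨ʳ m ∷ []
  step1-preserves I (r∨𝔣̄₁ m _)             = below I ∨ʳ m ∷ []
  step1-preserves I (r∨𝔣̄₂ m _)             = below I ∨ˡ m ∷ []
  step1-preserves I (r▲T m _ _ _)          = below I ▲ m ∷ []
  step1-preserves I (r▲T′ m _ _ _ _ _)     = below I ▲ m ∷ below I ▲ m ∷ []
  step1-preserves I (r▲B m _ _)            = below I ▲ m ∷ below I ▲ m ∷ []
  step1-preserves I (r▲B⁺ m _ _)           = tt ∷ below I ▲ m ∷ below I ▲ m ∷ []
  step1-preserves I (r▲N m _ _)            = below I ▲ m ∷ below I ▲ m ∷ []
  step1-preserves I (r▲N⁺ m _ _)           = tt ∷ below I ▲ m ∷ below I ▲ m ∷ []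

  step2-preserves : ∀ {Γ Δ₁ Δ₂} → All (FormulaIn P) Γ → Step2 Γ Δ₁ Δ₂
                  → All (FormulaIn P) Δ₁ × All (FormulaIn P) Δ₂
  step2-preserves I (cut _ (_ , _ , _ , m , ψ⊑φ)) =
    below I ψ⊑φ m ∷ [] , below I ψ⊑φ m ∷ []
  step2-preserves I (r▲F m _ _ _ _) =
    tt ∷ tt ∷ below I ▲ m ∷ below I ▲ m ∷ [] , tt ∷ tt ∷ below I ▲ m ∷ below I ▲ m ∷ []

  closedTree-preserves : ∀ {Γ} (t : ClosedTree Γ) → All (FormulaIn P) Γ
                       → ∀ {x} → x ∈T t → FormulaIn P x
  closedTree-preserves t I (here m) = lookup I m
  closedTree-preserves (ext s t) I (inExt x) =
    closedTree-preserves t (++⁺ (step1-preserves I s) I) x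
  closedTree-preserves (split s t₁ t₂) I (inSplˡ x) with step2-preserves I s
  ... | I₁ , _ = closedTree-preserves t₁ (++⁺ I₁ I) x
  closedTree-preserves (split s t₁ t₂) I (inSplʳ x) with step2-preserves I s
  ... | _ , I₂ = closedTree-preserves t₂ (++⁺ I₂ I) x

corollary2 : ∀ (φ χ : Fm) (p : Proof φ χ) (w : ℕ) (ψ : Fm) (v : V)
    → lf w ψ v ∈T p → (ψ ⊑ φ) ⊎ (ψ ⊑ χ)
corollary2 φ χ p w ψ v =
  closedTree-preserves closed p (inj₁ ⊑-refl ∷ inj₂ ⊑-refl ∷ [])
  where
  closed : SubformulaClosed ((_⊑ φ) ∪ (_⊑ χ))
  closed = ∪-subformulaClosed (subformulasOf-closed φ) (subformulasOf-closed χ)
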